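{- Let $G=(A,B,\mathcal{E})$ be a bipartite graph containing no induced $n\Lambda_k$, let $r$ be a positive integer and suppose $|A|\ge(n-1)r$. Then there are a set $W\subseteq A$ with $|W|=(n-1)r$ and a set $B^c\subseteq B$ such that every vertex $a\in A\setminus W$ satisfies $|N(a)\setminus B^c|<kr$ and every vertex $b\in B^c$ has at least $r$ neighbours in $W$. Furthermore, there is a subset $W'\subseteq W$ with $|W'|=n-1$ such that $B^c\subseteq N(W')$ and every vertex of $W'$ has at most $kr$ neighbours in $B\setminus B^c$.
   Context: $\Lambda_k$ is the star with centre in the top part $A$ and $k$ leaves in the bottom part $B$; $n\Lambda_k$ is the disjoint union of $n$ copies; induced containment respects sides. $N(S)=\bigcup_{v\in S}N(v)$. -}

module Defs where

open import Data.Nat using (ℕ; _*_; _<_; _≤_)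
open import Data.Bool using (Bool; true; false)
open import Data.Fin using (Fin)
open import Data.Fin.Subset using (Subset; _∈_; _∉_; _⊆_; ∣_∣; ∁; _∩_)
open import Data.Vec using (tabulate)
open import Data.Product using (Σ; _×_; _,_; ∃)
open import Relation.Binary.PropositionalEquality using (_≡_)
open import Function.Bundles using (_⇔_)

record BipGraph (p q : ℕ) : Set where
  field
    adj : Fin p → Fin q → Bool

open BipGraph public

N : ∀ {p q} → BipGraph p q → Fin p → Subset q
N G a = tabulate (λ b → adj G a b)

Nᴮ : ∀ {p q} → BipGraph p q → Fin q → Subset p
Nᴮ G b = tabulate (λ a → adj G a b)

_∈N[_]_ : ∀ {p q} → Fin q → BipGraph p q → Subset p → Set
b ∈N[ G ] S = ∃ λ a → a ∈ S × adj G a b ≡ true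

_⊆N[_]_ : ∀ {p q} → Subset q → BipGraph p q → Subset p → Set
C ⊆N[ G ] S = ∀ b → b ∈ C → b ∈N[ G ] S

-- G contains an induced copy of nΛ_k respecting sides:
-- n distinct centres c i in A, and nk distinct leaves ℓ i j in B,
-- such that c i is adjacent to ℓ i' j iff i ≡ i'.
-- (A and B are independent sets in a bipartite graph, so this is exactly
-- induced containment with centres in A and leaves in B.)
ContainsInducedNΛ : ∀ {p q} → ℕ → ℕ → BipGraph p q → Set
ContainsInducedNΛ {p} {q} n k G =
  Σ (Fin n → Fin p) λ c →
  Σ (Fin n → Fin k → Fin q) λ ℓ →
    (∀ i i' → c i ≡ c i' → i ≡ i')
  × (∀ i j i' j' → ℓ i j ≡ ℓ i' j' → (i ≡ i' × j ≡ j'))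
  × (∀ i i' j → (adj G (c i) (ℓ i' j) ≡ true) ⇔ (i ≡ i'))

module Submission where

-- Lemma 19.  Write m = n - 1, let N(T) be the neighbourhood of a set T of top vertices,
-- and call the neighbours of x outside N(T) the new neighbours of x over T.
--
-- Inside every A' with |A'| ≥ m there is an m-set W ⊆ A'
-- such that each a ∈ A' \ W has fewer than k new neighbours over W.  Take an m-set W
-- with |N(W)| maximal; if some a had k new neighbours, then in S = W ∪ {a} either every
-- vertex has k private neighbours (neighbours of no other vertex of S), which spans an
-- induced (m+1)Λ_k, or some w ∈ W has fewer than k, and exchanging w for a enlarges N(W).
-- The maximum is reached by iterating such exchanges on the bounded measure |N(W)|.
--
-- Choose a layer W₁ in A', recurse inside A' \ W₁, and put
-- W = W₁ ∪ W_rest, Bᶜ = N(W₁) ∩ Bᶜ_rest and W' = W'_rest.  Degrees into B \ Bᶜ add up to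
-- less than kr, and every vertex of Bᶜ gains one neighbour in W per layer.

open import Defs
open import Data.Nat using (ℕ; zero; suc; _+_; _*_; _<_; _≤_; _∸_; z≤n; _≤?_)
open import Data.Nat.Properties
  using ( +-suc; +-comm; +-identityʳ; *-identityʳ; *-suc; suc-injective; m≤m+n; m≤n+m; m≤m*n; ≤-pred
        ; ≤-trans; ≤-reflexive; <-≤-trans; ≤-<-trans; <⇒≤; <⇒≱; ≰⇒>; ≮⇒≥; <-irrefl
        ; +-mono-≤; +-monoˡ-≤; +-mono-<-≤; +-mono-≤-<; +-cancelˡ-≤; module ≤-Reasoning )
open import Data.Bool using (Bool; true; false)
open import Data.Bool.Properties using (T-≡) renaming (_≟_ to _≟ᵇ_)
open import Data.Fin using (Fin; zero; suc; _≟_)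
open import Data.Fin.Properties using (any?) renaming (suc-injective to fsuc-injective)
open import Data.Fin.Subset
  using (Subset; _∈_; _∉_; _⊆_; ∣_∣; ∁; _∩_; _∪_; ⁅_⁆; ⊤) renaming (⊥ to ∅)
open import Data.Fin.Subset.Properties
  using ( _∈?_; ∈⊤; ∣⊤∣≡n; ∣p∣≤n; ∉⊥; ∣⊥∣≡0; Empty-unique; drop-∷-⊆; s⊆s; ⊆-antisym
        ; p⊆q⇒∣p∣≤∣q∣; x∈∁p⇒x∉p; x∉p⇒x∈∁p
        ; x∈⁅x⁆; x∈⁅y⁆⇒x≡y; x≢y⇒x∉⁅y⁆; ∣⁅x⁆∣≡1
        ; p∩q⊆p; p∩q⊆q; x∈p∩q⁺; x∈p∩q⁻; p⊆p∪q; q⊆p∪q; x∈p∪q⁻; ∩-distribˡ-∪ )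
open import Data.Vec using ([]; _∷_; tabulate; here; there)
open import Data.Vec.Properties using (lookup∘tabulate; []=⇒lookup; lookup⇒[]=)
open import Data.Product using (Σ; ∃; _×_; _,_; proj₁; proj₂)
open import Data.Sum using (_⊎_; inj₁; inj₂)
open import Data.Empty using (⊥-elim)
open import Function using (_∘_)
open import Function.Bundles using (_⇔_; mk⇔; Equivalence)
open import Function.Definitions using (Injective)
open import Relation.Binary.PropositionalEquality
  using (_≡_; _≢_; refl; sym; trans; cong; cong₂; subst; module ≡-Reasoning)
open import Relation.Nullary using (¬_; yes; no; ¬?)
open import Relation.Nullary.Decidable using (isYes; toWitness; fromWitness; _×-dec_)
open import Relation.Unary using (Pred; Decidable)

open Equivalence using (to; from)

infixl 8 _∖_
_∖_ : ∀ {n} → Subset n → Subset n → Subset n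
p ∖ q = p ∩ ∁ q

∈∖⁺ : ∀ {n} {p q : Subset n} {x} → x ∈ p → x ∉ q → x ∈ p ∖ q
∈∖⁺ x∈p x∉q = x∈p∩q⁺ (x∈p , x∉p⇒x∈∁p x∉q)

∈∖⁻ : ∀ {n} {p q : Subset n} {x} → x ∈ p ∖ q → x ∈ p × x ∉ q
∈∖⁻ {p = p} {q} x∈p∖q = proj₁ both , x∈∁p⇒x∉p (proj₂ both)
  where both = x∈p∩q⁻ p (∁ q) x∈p∖q

∣∣≡0 : ∀ {n} {p : Subset n} → (∀ {x} → x ∉ p) → ∣ p ∣ ≡ 0
∣∣≡0 {n} noElement = trans (cong ∣_∣ (Empty-unique λ (_ , x∈p) → noElement x∈p)) (∣⊥∣≡0 n)

⁅x⁆⊆p : ∀ {n} {p : Subset n} {x} → x ∈ p → ⁅ x ⁆ ⊆ p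
⁅x⁆⊆p {p = p} {x} x∈p y∈⁅x⁆ = subst (_∈ p) (sym (x∈⁅y⁆⇒x≡y x y∈⁅x⁆)) x∈p

∈∪⁅⁆⁻ : ∀ {n} {p : Subset n} {x y} → y ∈ p ∪ ⁅ x ⁆ → y ∈ p ⊎ y ≡ x
∈∪⁅⁆⁻ {p = p} {x} y∈ with x∈p∪q⁻ p ⁅ x ⁆ y∈
... | inj₁ y∈p   = inj₁ y∈p
... | inj₂ y∈⁅x⁆ = inj₂ (x∈⁅y⁆⇒x≡y x y∈⁅x⁆)

∈∖⁅⁆-or : ∀ {n} {p : Subset n} {x y} → y ∈ p → y ∈ p ∖ ⁅ x ⁆ ⊎ y ≡ x
∈∖⁅⁆-or {x = x} {y} y∈p with y ≟ x
... | yes y≡x = inj₂ y≡x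
... | no  y≢x = inj₁ (∈∖⁺ y∈p (x≢y⇒x∉⁅y⁆ y≢x))

p∪⁅x⁆∖⁅x⁆⊆p : ∀ {n} (p : Subset n) x → (p ∪ ⁅ x ⁆) ∖ ⁅ x ⁆ ⊆ p
p∪⁅x⁆∖⁅x⁆⊆p p x y∈ with ∈∖⁻ y∈
... | y∈p∪x , y∉⁅x⁆ with ∈∪⁅⁆⁻ y∈p∪x
...   | inj₁ y∈p  = y∈p
...   | inj₂ refl = ⊥-elim (y∉⁅x⁆ (x∈⁅x⁆ x))

1≤∣p∣ : ∀ {n} {p : Subset n} {x} → x ∈ p → 1 ≤ ∣ p ∣
1≤∣p∣ {x = x} x∈p = subst (_≤ _) (∣⁅x⁆∣≡1 x) (p⊆q⇒∣p∣≤∣q∣ (⁅x⁆⊆p x∈p))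

∣p∪q∣+∣p∩q∣ : ∀ {n} (p q : Subset n) → ∣ p ∪ q ∣ + ∣ p ∩ q ∣ ≡ ∣ p ∣ + ∣ q ∣
∣p∪q∣+∣p∩q∣ []          []          = refl
∣p∪q∣+∣p∩q∣ (true ∷ p)  (true ∷ q)  =
  cong suc (trans (+-suc _ _) (trans (cong suc (∣p∪q∣+∣p∩q∣ p q)) (sym (+-suc _ _))))
∣p∪q∣+∣p∩q∣ (true ∷ p)  (false ∷ q) = cong suc (∣p∪q∣+∣p∩q∣ p q)
∣p∪q∣+∣p∩q∣ (false ∷ p) (true ∷ q)  = trans (cong suc (∣p∪q∣+∣p∩q∣ p q)) (sym (+-suc _ _))
∣p∪q∣+∣p∩q∣ (false ∷ p) (false ∷ q) = ∣p∪q∣+∣p∩q∣ p q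

∣p∪q∣-disjoint : ∀ {n} (p q : Subset n) → (∀ {x} → x ∈ p → x ∉ q) → ∣ p ∪ q ∣ ≡ ∣ p ∣ + ∣ q ∣
∣p∪q∣-disjoint p q disjoint = begin
  ∣ p ∪ q ∣              ≡⟨ sym (+-identityʳ _) ⟩
  ∣ p ∪ q ∣ + 0          ≡⟨ cong (∣ p ∪ q ∣ +_) (sym (∣∣≡0 noCommon)) ⟩
  ∣ p ∪ q ∣ + ∣ p ∩ q ∣  ≡⟨ ∣p∪q∣+∣p∩q∣ p q ⟩
  ∣ p ∣ + ∣ q ∣          ∎
  where
  open ≡-Reasoning
  noCommon : ∀ {x} → x ∉ p ∩ q
  noCommon x∈p∩q = let (x∈p , x∈q) = x∈p∩q⁻ p q x∈p∩q in disjoint x∈p x∈q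

∣p∪q∣≤∣p∣+∣q∣ : ∀ {n} (p q : Subset n) → ∣ p ∪ q ∣ ≤ ∣ p ∣ + ∣ q ∣
∣p∪q∣≤∣p∣+∣q∣ p q = subst (∣ p ∪ q ∣ ≤_) (∣p∪q∣+∣p∩q∣ p q) (m≤m+n _ _)

∣p∣≡∣p∖q∣+∣q∣ : ∀ {n} (p q : Subset n) → q ⊆ p → ∣ p ∣ ≡ ∣ p ∖ q ∣ + ∣ q ∣
∣p∣≡∣p∖q∣+∣q∣ []          []          _   = refl
∣p∣≡∣p∖q∣+∣q∣ (true ∷ p)  (true ∷ q)  q⊆p =
  trans (cong suc (∣p∣≡∣p∖q∣+∣q∣ p q (drop-∷-⊆ q⊆p))) (sym (+-suc _ _))
∣p∣≡∣p∖q∣+∣q∣ (true ∷ p)  (false ∷ q) q⊆p = cong suc (∣p∣≡∣p∖q∣+∣q∣ p q (drop-∷-⊆ q⊆p))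
∣p∣≡∣p∖q∣+∣q∣ (false ∷ p) (true ∷ q)  q⊆p with q⊆p here
... | ()
∣p∣≡∣p∖q∣+∣q∣ (false ∷ p) (false ∷ q) q⊆p = ∣p∣≡∣p∖q∣+∣q∣ p q (drop-∷-⊆ q⊆p)

∣p∪⁅x⁆∣ : ∀ {n} {p : Subset n} {x} → x ∉ p → ∣ p ∪ ⁅ x ⁆ ∣ ≡ suc ∣ p ∣
∣p∪⁅x⁆∣ {p = p} {x} x∉p = begin
  ∣ p ∪ ⁅ x ⁆ ∣      ≡⟨ ∣p∪q∣-disjoint p ⁅ x ⁆ x-new ⟩
  ∣ p ∣ + ∣ ⁅ x ⁆ ∣  ≡⟨ cong (∣ p ∣ +_) (∣⁅x⁆∣≡1 x) ⟩
  ∣ p ∣ + 1          ≡⟨ +-comm ∣ p ∣ 1 ⟩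
  suc ∣ p ∣          ∎
  where
  open ≡-Reasoning
  x-new : ∀ {y} → y ∈ p → y ∉ ⁅ x ⁆
  x-new y∈p y∈⁅x⁆ = x∉p (subst (_∈ p) (x∈⁅y⁆⇒x≡y x y∈⁅x⁆) y∈p)

∣p∖⁅x⁆∣ : ∀ {n} {p : Subset n} {x} → x ∈ p → suc ∣ p ∖ ⁅ x ⁆ ∣ ≡ ∣ p ∣
∣p∖⁅x⁆∣ {p = p} {x} x∈p = begin
  suc ∣ p ∖ ⁅ x ⁆ ∣          ≡⟨ +-comm 1 ∣ p ∖ ⁅ x ⁆ ∣ ⟩
  ∣ p ∖ ⁅ x ⁆ ∣ + 1          ≡⟨ cong (∣ p ∖ ⁅ x ⁆ ∣ +_) (∣⁅x⁆∣≡1 x) ⟨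
  ∣ p ∖ ⁅ x ⁆ ∣ + ∣ ⁅ x ⁆ ∣  ≡⟨ ∣p∣≡∣p∖q∣+∣q∣ p ⁅ x ⁆ (⁅x⁆⊆p x∈p) ⟨
  ∣ p ∣                      ∎
  where open ≡-Reasoning

-- Removing two overlapping sets: p \ (q ∩ r) is covered by p \ q and p \ r.
∣p∖q∩r∣≤ : ∀ {n} (p q r : Subset n) → ∣ p ∖ (q ∩ r) ∣ ≤ ∣ p ∖ q ∣ + ∣ p ∖ r ∣
∣p∖q∩r∣≤ p q r = ≤-trans (p⊆q⇒∣p∣≤∣q∣ covered) (∣p∪q∣≤∣p∣+∣q∣ (p ∖ q) (p ∖ r))
  where
  covered : p ∖ (q ∩ r) ⊆ p ∖ q ∪ p ∖ r
  covered {x} x∈ with ∈∖⁻ {q = q ∩ r} x∈ | x ∈? q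
  ... | x∈p , x∉q∩r | yes x∈q = q⊆p∪q (p ∖ q) _ (∈∖⁺ x∈p λ x∈r → x∉q∩r (x∈p∩q⁺ (x∈q , x∈r)))
  ... | x∈p , _     | no x∉q  = p⊆p∪q (p ∖ r) (∈∖⁺ x∈p x∉q)

choose : ∀ {n} m (p : Subset n) → m ≤ ∣ p ∣ → Σ (Subset n) λ q → q ⊆ p × ∣ q ∣ ≡ m
choose {n} zero p _ = ∅ , (λ x∈∅ → ⊥-elim (∉⊥ x∈∅)) , ∣⊥∣≡0 n
choose (suc m) (true ∷ p) m<∣p∣ =
  let (q , q⊆p , ∣q∣) = choose m p (≤-pred m<∣p∣)
  in true ∷ q , s⊆s q⊆p , cong suc ∣q∣
choose (suc m) (false ∷ p) m<∣p∣ =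
  let (q , q⊆p , ∣q∣) = choose (suc m) p m<∣p∣ in false ∷ q , s⊆s q⊆p , ∣q∣

enumerate : ∀ {n} k (p : Subset n) → k ≤ ∣ p ∣ →
  Σ (Fin k → Fin n) λ f → Injective _≡_ _≡_ f × (∀ j → f j ∈ p)
enumerate zero p _ = (λ ()) , (λ { {()} }) , (λ ())
enumerate (suc k) (true ∷ p) k<∣p∣ =
  let (f , f-inj , f∈p) = enumerate k p (≤-pred k<∣p∣) in
  (λ { zero → zero ; (suc j) → suc (f j) }) ,
  (λ { {zero} {zero} _ → refl
     ; {suc i} {suc j} e → cong suc (f-inj (fsuc-injective e)) }) ,
  (λ { zero → here ; (suc j) → there (f∈p j) })
enumerate (suc k) (false ∷ p) k≤∣p∣ =
  let (f , f-inj , f∈p) = enumerate (suc k) p k≤∣p∣ in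
  suc ∘ f , f-inj ∘ fsuc-injective , there ∘ f∈p

∈tabulate⇔ : ∀ {n} {f : Fin n → Bool} {x} → x ∈ tabulate f ⇔ f x ≡ true
∈tabulate⇔ {f = f} {x} = mk⇔
  (λ x∈ → trans (sym (lookup∘tabulate f x)) ([]=⇒lookup x∈))
  (λ fx → lookup⇒[]= x (tabulate f) (trans (lookup∘tabulate f x) fx))

⟦_⟧ : ∀ {n ℓ} {P : Pred (Fin n) ℓ} → Decidable P → Subset n
⟦ P? ⟧ = tabulate (λ x → isYes (P? x))

∈⟦⟧⁺ : ∀ {n ℓ} {P : Pred (Fin n) ℓ} (P? : Decidable P) {x} → P x → x ∈ ⟦ P? ⟧
∈⟦⟧⁺ P? {x} px = from ∈tabulate⇔ (to T-≡ (fromWitness {a? = P? x} px))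

∈⟦⟧⁻ : ∀ {n ℓ} {P : Pred (Fin n) ℓ} (P? : Decidable P) {x} → x ∈ ⟦ P? ⟧ → P x
∈⟦⟧⁻ P? {x} x∈ = toWitness {a? = P? x} (from T-≡ (to ∈tabulate⇔ x∈))

improve-until : ∀ {a ℓ} {X : Set a} (Good : X → Set ℓ) (μ : X → ℕ) {bound : ℕ} →
  (∀ x → μ x ≤ bound) → (∀ x → Good x ⊎ ∃ λ y → μ x < μ y) → X → ∃ Good
improve-until Good μ {bound} bounded step x₀ = go (suc bound) x₀ (m≤n+m _ (μ x₀))
  where
  -- the fuel exceeds the room bound - μ x left for improvement
  go : ∀ fuel x → bound < μ x + fuel → ∃ Good
  go zero x room = ⊥-elim (<⇒≱ (subst (bound <_) (+-identityʳ (μ x)) room) (bounded x))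
  go (suc fuel) x room with step x
  ... | inj₁ good     = x , good
  ... | inj₂ (y , x<y) =
    go fuel y (<-≤-trans (subst (bound <_) (+-suc (μ x) fuel) room) (+-monoˡ-≤ fuel x<y))

exchange : ∀ {a b c d} → a + b ≡ c + d → d < b → a < c
exchange a+b≡c+d d<b = ≰⇒> λ c≤a → <-irrefl (sym a+b≡c+d) (+-mono-≤-< c≤a d<b)

module _ {p q} (G : BipGraph p q) where

  ∈N⇔ : ∀ {a b} → b ∈ N G a ⇔ adj G a b ≡ true
  ∈N⇔ = ∈tabulate⇔

  ∈Nᴮ⇔ : ∀ {a b} → a ∈ Nᴮ G b ⇔ adj G a b ≡ true
  ∈Nᴮ⇔ = ∈tabulate⇔

  ∈N[]? : ∀ S → Decidable (λ b → b ∈N[ G ] S)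
  ∈N[]? S b = any? λ a → a ∈? S ×-dec adj G a b ≟ᵇ true

  Nset : Subset p → Subset q
  Nset S = ⟦ ∈N[]? S ⟧

  Nset⁺ : ∀ {S a b} → a ∈ S → adj G a b ≡ true → b ∈ Nset S
  Nset⁺ {S} a∈S ab = ∈⟦⟧⁺ (∈N[]? S) (_ , a∈S , ab)

  Nset⁻ : ∀ {S b} → b ∈ Nset S → b ∈N[ G ] S
  Nset⁻ {S} = ∈⟦⟧⁻ (∈N[]? S)

  Nset-mono : ∀ {S T} → S ⊆ T → Nset S ⊆ Nset T
  Nset-mono S⊆T b∈NS = let (a , a∈S , ab) = Nset⁻ b∈NS in Nset⁺ (S⊆T a∈S) ab

  N⊆Nset : ∀ {S a} → a ∈ S → N G a ⊆ Nset S
  N⊆Nset a∈S b∈Na = Nset⁺ a∈S (to ∈N⇔ b∈Na)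

  Nset-degree : ∀ {W b} → b ∈ Nset W → 1 ≤ ∣ Nᴮ G b ∩ W ∣
  Nset-degree b∈NW = let (a , a∈W , ab) = Nset⁻ b∈NW in 1≤∣p∣ (x∈p∩q⁺ (from ∈Nᴮ⇔ ab , a∈W))

  New : Subset p → Fin p → Subset q
  New T x = N G x ∖ Nset T

  New-antitone : ∀ {T T' x} → T ⊆ T' → New T' x ⊆ New T x
  New-antitone T⊆T' b∈New = let (b∈N , b∉NT') = ∈∖⁻ b∈New in ∈∖⁺ b∈N (b∉NT' ∘ Nset-mono T⊆T')

  ∣New∣-self : ∀ {T x} → x ∈ T → ∣ New T x ∣ ≡ 0
  ∣New∣-self x∈T = ∣∣≡0 λ b∈New → let (b∈N , b∉NT) = ∈∖⁻ b∈New in b∉NT (N⊆Nset x∈T b∈N)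

  ∣Nset∣-grow : ∀ {T S x} → T ⊆ S → x ∈ S → (∀ {y} → y ∈ S → y ∈ T ⊎ y ≡ x) →
    ∣ Nset S ∣ ≡ ∣ Nset T ∣ + ∣ New T x ∣
  ∣Nset∣-grow {T} {S} {x} T⊆S x∈S S⊆T+x = trans (cong ∣_∣ NS≡) (∣p∪q∣-disjoint _ _ disjoint)
    where
    NS≡ : Nset S ≡ Nset T ∪ New T x
    NS≡ = ⊆-antisym ⊆NT∪New NT∪New⊆
      where
      ⊆NT∪New : Nset S ⊆ Nset T ∪ New T x
      ⊆NT∪New {b} b∈NS with Nset⁻ b∈NS | b ∈? Nset T
      ... | _ | yes b∈NT = p⊆p∪q _ b∈NT
      ... | a , a∈S , ab | no b∉NT with S⊆T+x a∈S
      ...   | inj₁ a∈T  = ⊥-elim (b∉NT (Nset⁺ a∈T ab))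
      ...   | inj₂ refl = q⊆p∪q _ _ (∈∖⁺ (from ∈N⇔ ab) b∉NT)
      NT∪New⊆ : Nset T ∪ New T x ⊆ Nset S
      NT∪New⊆ b∈ with x∈p∪q⁻ (Nset T) (New T x) b∈
      ... | inj₁ b∈NT  = Nset-mono T⊆S b∈NT
      ... | inj₂ b∈New = N⊆Nset x∈S (proj₁ (∈∖⁻ b∈New))
    disjoint : ∀ {b} → b ∈ Nset T → b ∉ New T x
    disjoint b∈NT b∈New = proj₂ (∈∖⁻ b∈New) b∈NT

  Private : Subset p → Fin p → Subset q
  Private S x = New (S ∖ ⁅ x ⁆) x

  private-adj : ∀ {S x b} → b ∈ Private S x → adj G x b ≡ true
  private-adj b∈Priv = to ∈N⇔ (proj₁ (∈∖⁻ b∈Priv))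

  private-excl : ∀ {S x z b} → b ∈ Private S x → z ∈ S → z ≢ x → adj G z b ≢ true
  private-excl b∈Priv z∈S z≢x zb = proj₂ (∈∖⁻ b∈Priv) (Nset⁺ (∈∖⁺ z∈S (x≢y⇒x∉⁅y⁆ z≢x)) zb)

  private-copy : ∀ n k S → n ≤ ∣ S ∣ → (∀ {x} → x ∈ S → k ≤ ∣ Private S x ∣) →
    ContainsInducedNΛ n k G
  private-copy n k S n≤∣S∣ manyPrivate =
    c , ℓ , (λ _ _ → c-inj) , ℓ-inj , (λ i i' j → mk⇔ (adj⇒same i i' j) (same⇒adj i i' j))
    where
    centres : Σ (Fin n → Fin p) λ f → Injective _≡_ _≡_ f × (∀ i → f i ∈ S)
    centres = enumerate n S n≤∣S∣
    c : Fin n → Fin p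
    c = proj₁ centres
    c-inj : Injective _≡_ _≡_ c
    c-inj = proj₁ (proj₂ centres)
    c∈S : ∀ i → c i ∈ S
    c∈S = proj₂ (proj₂ centres)
    leaves : ∀ i → Σ (Fin k → Fin q) λ f → Injective _≡_ _≡_ f × (∀ j → f j ∈ Private S (c i))
    leaves i = enumerate k (Private S (c i)) (manyPrivate (c∈S i))
    ℓ : Fin n → Fin k → Fin q
    ℓ i = proj₁ (leaves i)
    ℓ-private : ∀ i j → ℓ i j ∈ Private S (c i)
    ℓ-private i = proj₂ (proj₂ (leaves i))
    adj⇒same : ∀ i i' j → adj G (c i) (ℓ i' j) ≡ true → i ≡ i'
    adj⇒same i i' j cℓ with i ≟ i'
    ... | yes i≡i' = i≡i'
    ... | no  i≢i' = ⊥-elim (private-excl (ℓ-private i' j) (c∈S i) (i≢i' ∘ c-inj) cℓ)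
    same⇒adj : ∀ i i' j → i ≡ i' → adj G (c i) (ℓ i' j) ≡ true
    same⇒adj i .i j refl = private-adj (ℓ-private i j)
    -- equal leaves lie in the same star, where leaves are enumerated injectively
    ℓ-inj : ∀ i j i' j' → ℓ i j ≡ ℓ i' j' → i ≡ i' × j ≡ j'
    ℓ-inj i j i' j' ℓ≡ with adj⇒same i i' j' (subst (λ b → adj G (c i) b ≡ true) ℓ≡ (same⇒adj i i j refl))
    ... | refl = refl , proj₁ (proj₂ (leaves i)) ℓ≡

  record Within (A' : Subset p) (m : ℕ) : Set where
    field
      set    : Subset p
      set⊆A' : set ⊆ A'
      ∣set∣  : ∣ set ∣ ≡ m

  Saturating : ℕ → Subset p → Subset p → Set
  Saturating k A' W = ∀ a → a ∈ A' → a ∉ W → ∣ New W a ∣ < k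

  module OneLayer (m k : ℕ) (noCopy : ¬ ContainsInducedNΛ (suc m) k G) (A' : Subset p) where

    module Exchange (L : Within A' m) {a} (a∈A' : a ∈ A') (a∉W : a ∉ Within.set L)
                    (k≤new : k ≤ ∣ New (Within.set L) a ∣) where
      open Within L renaming (set to W; set⊆A' to W⊆A'; ∣set∣ to ∣W∣)

      S : Subset p
      S = W ∪ ⁅ a ⁆

      W⊆S : W ⊆ S
      W⊆S = p⊆p∪q ⁅ a ⁆

      a∈S : a ∈ S
      a∈S = q⊆p∪q W ⁅ a ⁆ (x∈⁅x⁆ a)

      S⊆A' : S ⊆ A'
      S⊆A' y∈S with ∈∪⁅⁆⁻ y∈S
      ... | inj₁ y∈W  = W⊆A' y∈W
      ... | inj₂ refl = a∈A'

      ∣S∣ : ∣ S ∣ ≡ suc m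
      ∣S∣ = trans (∣p∪⁅x⁆∣ a∉W) (cong suc ∣W∣)

      -- S spans no induced (m + 1)Λ_k, and a has at least k private neighbours in S
      -- (its new neighbours over W), so some w ∈ W has fewer than k.
      poor-vertex : ∃ λ w → w ∈ W × ∣ Private S w ∣ < k
      poor-vertex with any? (λ w → w ∈? W ×-dec suc ∣ Private S w ∣ ≤? k)
      ... | yes poor  = poor
      ... | no noPoor = ⊥-elim (noCopy (private-copy (suc m) k S (≤-reflexive (sym ∣S∣)) rich))
        where
        rich : ∀ {x} → x ∈ S → k ≤ ∣ Private S x ∣
        rich x∈S with ∈∪⁅⁆⁻ x∈S
        ... | inj₁ x∈W  = ≮⇒≥ λ poor → noPoor (_ , x∈W , poor)
        ... | inj₂ refl = ≤-trans k≤new (p⊆q⇒∣p∣≤∣q∣ (New-antitone (p∪⁅x⁆∖⁅x⁆⊆p W a)))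

      -- Exchanging such a w for a strictly enlarges the neighbourhood: N(S) is N(W) plus
      -- the new neighbours of a, and also N(S \ {w}) plus the fewer private neighbours of w.
      swap : ∀ {w} → w ∈ W → ∣ Private S w ∣ < k →
        Σ (Within A' m) λ W₂ → ∣ Nset W ∣ < ∣ Nset (Within.set W₂) ∣
      swap {w} w∈W poor =
        record { set = S ∖ ⁅ w ⁆
               ; set⊆A' = S⊆A' ∘ proj₁ ∘ ∈∖⁻
               ; ∣set∣ = suc-injective (trans (∣p∖⁅x⁆∣ (W⊆S w∈W)) ∣S∣) } ,
        exchange (trans (sym (∣Nset∣-grow W⊆S a∈S ∈∪⁅⁆⁻))
                        (∣Nset∣-grow (proj₁ ∘ ∈∖⁻) (W⊆S w∈W) ∈∖⁅⁆-or))
                 (<-≤-trans poor k≤new)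

      improvement : Σ (Within A' m) λ W₂ → ∣ Nset W ∣ < ∣ Nset (Within.set W₂) ∣
      improvement = let (w , w∈W , poor) = poor-vertex in swap w∈W poor

    layer : m ≤ ∣ A' ∣ → Σ (Within A' m) λ W → Saturating k A' (Within.set W)
    layer m≤∣A'∣ = improve-until (Saturating k A' ∘ Within.set) (∣_∣ ∘ Nset ∘ Within.set)
      (∣p∣≤n ∘ Nset ∘ Within.set) improve initial
      where
      initial : Within A' m
      initial = let (W , W⊆A' , ∣W∣) = choose m A' m≤∣A'∣
                in record { set = W ; set⊆A' = W⊆A' ; ∣set∣ = ∣W∣ }
      improve : (W : Within A' m) → Saturating k A' (Within.set W) ⊎
                ∃ λ W₂ → ∣ Nset (Within.set W) ∣ < ∣ Nset (Within.set W₂) ∣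
      improve W with any? (λ a → a ∈? A' ×-dec ¬? (a ∈? Within.set W) ×-dec k ≤? ∣ New (Within.set W) a ∣)
      ... | no noneRich = inj₁ λ a a∈A' a∉W → ≰⇒> λ k≤new → noneRich (a , a∈A' , a∉W , k≤new)
      ... | yes (a , a∈A' , a∉W , k≤new) = inj₂ (Exchange.improvement W a∈A' a∉W k≤new)

  record Layering (m k r : ℕ) (A' : Subset p) : Set where
    field
      W              : Subset p
      Bc             : Subset q
      W⊆A'           : W ⊆ A'
      ∣W∣            : ∣ W ∣ ≡ m * r
      sparse-outside : ∀ a → a ∈ A' → a ∉ W → ∣ N G a ∖ Bc ∣ < k * r
      dense-core     : ∀ b → b ∈ Bc → r ≤ ∣ Nᴮ G b ∩ W ∣
      W'             : Subset p
      W'⊆W           : W' ⊆ W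
      ∣W'∣           : ∣ W' ∣ ≡ m
      Bc⊆NW'         : Bc ⊆N[ G ] W'
      W'-sparse      : ∀ a → a ∈ W' → ∣ N G a ∖ Bc ∣ ≤ k * r

  first-layer : ∀ {m k A'} (L : Within A' m) → Saturating k A' (Within.set L) → Layering m k 1 A'
  first-layer {m} {k} record { set = W₁ ; set⊆A' = W₁⊆A' ; ∣set∣ = ∣W₁∣ } saturating = record
    { W = W₁ ; Bc = Nset W₁ ; W⊆A' = W₁⊆A'
    ; ∣W∣ = trans ∣W₁∣ (sym (*-identityʳ m))
    ; sparse-outside = λ a a∈A' a∉W₁ →
        subst (∣ New W₁ a ∣ <_) (sym (*-identityʳ k)) (saturating a a∈A' a∉W₁)
    ; dense-core = λ b → Nset-degree
    ; W' = W₁ ; W'⊆W = λ a∈W₁ → a∈W₁ ; ∣W'∣ = ∣W₁∣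
    ; Bc⊆NW' = λ b → Nset⁻
    ; W'-sparse = λ a a∈W₁ → subst (_≤ k * 1) (sym (∣New∣-self a∈W₁)) z≤n
    }

  next-layer : ∀ {m k r A'} (L : Within A' m) → Saturating k A' (Within.set L) →
    Layering m k r (A' ∖ Within.set L) → Layering m k (suc r) A'
  next-layer {m} {k} {r} {A'} record { set = W₁ ; set⊆A' = W₁⊆A' ; ∣set∣ = ∣W₁∣ } saturating rest =
    record
    { W = W₁ ∪ R.W ; Bc = Nset W₁ ∩ R.Bc ; W⊆A' = W⊆A'
    ; ∣W∣ = trans (∣p∪q∣-disjoint W₁ R.W disjoint) (trans (cong₂ _+_ ∣W₁∣ R.∣W∣) (sym (*-suc m r)))
    ; sparse-outside = sparse-outside
    ; dense-core = dense-core
    ; W' = R.W' ; W'⊆W = q⊆p∪q W₁ R.W ∘ R.W'⊆W ; ∣W'∣ = R.∣W'∣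
    ; Bc⊆NW' = λ b → R.Bc⊆NW' b ∘ p∩q⊆q (Nset W₁) R.Bc
    ; W'-sparse = W'-sparse
    }
    where
    module R = Layering rest
    outside-W₁ : ∀ {a} → a ∈ R.W → a ∈ A' × a ∉ W₁
    outside-W₁ = ∈∖⁻ ∘ R.W⊆A'
    disjoint : ∀ {a} → a ∈ W₁ → a ∉ R.W
    disjoint a∈W₁ a∈R = proj₂ (outside-W₁ a∈R) a∈W₁
    W⊆A' : W₁ ∪ R.W ⊆ A'
    W⊆A' a∈W with x∈p∪q⁻ W₁ R.W a∈W
    ... | inj₁ a∈W₁ = W₁⊆A' a∈W₁
    ... | inj₂ a∈R  = proj₁ (outside-W₁ a∈R)
    -- missing Bᶜ means missing N(W₁) or missing the Bᶜ of the remaining layers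
    split : ∀ a → ∣ N G a ∖ (Nset W₁ ∩ R.Bc) ∣ ≤ ∣ New W₁ a ∣ + ∣ N G a ∖ R.Bc ∣
    split a = ∣p∖q∩r∣≤ (N G a) (Nset W₁) R.Bc
    sparse-outside : ∀ a → a ∈ A' → a ∉ W₁ ∪ R.W → ∣ N G a ∖ (Nset W₁ ∩ R.Bc) ∣ < k * suc r
    sparse-outside a a∈A' a∉W = subst (∣ N G a ∖ (Nset W₁ ∩ R.Bc) ∣ <_) (sym (*-suc k r))
      (≤-<-trans (split a) (+-mono-<-≤ (saturating a a∈A' a∉W₁)
                                       (<⇒≤ (R.sparse-outside a (∈∖⁺ a∈A' a∉W₁) a∉R))))
      where
      a∉W₁ : a ∉ W₁
      a∉W₁ = a∉W ∘ p⊆p∪q R.W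
      a∉R : a ∉ R.W
      a∉R = a∉W ∘ q⊆p∪q W₁ R.W
    W'-sparse : ∀ a → a ∈ R.W' → ∣ N G a ∖ (Nset W₁ ∩ R.Bc) ∣ ≤ k * suc r
    W'-sparse a a∈W' = subst (∣ N G a ∖ (Nset W₁ ∩ R.Bc) ∣ ≤_) (sym (*-suc k r))
      (≤-trans (split a) (+-mono-≤ (<⇒≤ (saturating a a∈A' a∉W₁)) (R.W'-sparse a a∈W')))
      where
      a∈A' : a ∈ A'
      a∈A' = proj₁ (outside-W₁ (R.W'⊆W a∈W'))
      a∉W₁ : a ∉ W₁
      a∉W₁ = proj₂ (outside-W₁ (R.W'⊆W a∈W'))
    -- a vertex of Bᶜ has a neighbour in W₁ and r more in the remaining layers
    dense-core : ∀ b → b ∈ Nset W₁ ∩ R.Bc → suc r ≤ ∣ Nᴮ G b ∩ (W₁ ∪ R.W) ∣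
    dense-core b b∈Bc = subst (suc r ≤_) (sym ∣Nᴮ∩W∣)
      (+-mono-≤ (Nset-degree (p∩q⊆p (Nset W₁) R.Bc b∈Bc))
                (R.dense-core b (p∩q⊆q (Nset W₁) R.Bc b∈Bc)))
      where
      ∣Nᴮ∩W∣ : ∣ Nᴮ G b ∩ (W₁ ∪ R.W) ∣ ≡ ∣ Nᴮ G b ∩ W₁ ∣ + ∣ Nᴮ G b ∩ R.W ∣
      ∣Nᴮ∩W∣ = trans (cong ∣_∣ (∩-distribˡ-∪ (Nᴮ G b) W₁ R.W))
        (∣p∪q∣-disjoint (Nᴮ G b ∩ W₁) (Nᴮ G b ∩ R.W) λ a∈₁ a∈R →
          disjoint (p∩q⊆q (Nᴮ G b) W₁ a∈₁) (p∩q⊆q (Nᴮ G b) R.W a∈R))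

  remaining : ∀ {m r A'} (L : Within A' m) → m * suc r ≤ ∣ A' ∣ → m * r ≤ ∣ A' ∖ Within.set L ∣
  remaining {m} {r} {A'} record { set = W₁ ; set⊆A' = W₁⊆A' ; ∣set∣ = ∣W₁∣ } large =
    +-cancelˡ-≤ m (m * r) ∣ A' ∖ W₁ ∣ (begin
      m + m * r          ≡⟨ *-suc m r ⟨
      m * suc r          ≤⟨ large ⟩
      ∣ A' ∣             ≡⟨ ∣p∣≡∣p∖q∣+∣q∣ A' W₁ W₁⊆A' ⟩
      ∣ A' ∖ W₁ ∣ + ∣ W₁ ∣ ≡⟨ cong (∣ A' ∖ W₁ ∣ +_) ∣W₁∣ ⟩
      ∣ A' ∖ W₁ ∣ + m    ≡⟨ +-comm ∣ A' ∖ W₁ ∣ m ⟩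
      m + ∣ A' ∖ W₁ ∣    ∎)
    where open ≤-Reasoning

  layering : ∀ {m k} → ¬ ContainsInducedNΛ (suc m) k G →
    ∀ r A' → m * suc r ≤ ∣ A' ∣ → Layering m k (suc r) A'
  layering {m} {k} noCopy zero A' large = first-layer (proj₁ W₁) (proj₂ W₁)
    where
    W₁ : Σ (Within A' m) λ L → Saturating k A' (Within.set L)
    W₁ = OneLayer.layer m k noCopy A' (≤-trans (m≤m*n m 1) large)
  layering {m} {k} noCopy (suc r) A' large =
    next-layer (proj₁ W₁) (proj₂ W₁) (layering noCopy r _ (remaining (proj₁ W₁) large))
    where
    W₁ : Σ (Within A' m) λ L → Saturating k A' (Within.set L)
    W₁ = OneLayer.layer m k noCopy A' (≤-trans (m≤m*n m (suc (suc r))) large)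

-- For n = 0 the empty family is an induced 0Λ_k; otherwise Lemma 19 is a layering of all
-- of A with r layers.
lemma19 : ∀ {p q} (G : BipGraph p q) (n k r : ℕ) →
    ¬ ContainsInducedNΛ n k G → 1 ≤ r → (n ∸ 1) * r ≤ p →
    Σ (Subset p) λ W → Σ (Subset q) λ Bc →
        ∣ W ∣ ≡ (n ∸ 1) * r
      × (∀ a → a ∉ W → ∣ N G a ∩ ∁ Bc ∣ < k * r)
      × (∀ b → b ∈ Bc → r ≤ ∣ Nᴮ G b ∩ W ∣)
      × Σ (Subset p) λ W' →
          W' ⊆ W
        × ∣ W' ∣ ≡ n ∸ 1
        × Bc ⊆N[ G ] W'
        × (∀ a → a ∈ W' → ∣ N G a ∩ ∁ Bc ∣ ≤ k * r)
lemma19 G zero k r noCopy _ _ = ⊥-elim (noCopy ((λ ()) , (λ ()) , (λ ()) , (λ ()) , (λ ())))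
lemma19 G (suc m) k zero _ () _
lemma19 {p} G (suc m) k (suc r) noCopy _ m[r+1]≤p =
  W , Bc , ∣W∣ , (λ a → sparse-outside a ∈⊤) , dense-core , W' , W'⊆W , ∣W'∣ , Bc⊆NW' , W'-sparse
  where open Layering (layering G noCopy r ⊤ (subst (m * suc r ≤_) (sym (∣⊤∣≡n p)) m[r+1]≤p))
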